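{- Let $r\geq 3$ and let $n_{1},n_{2},\ldots,n_{r}$ be positive integers with $n_{1}\geq n_{r}\geq n_{2}\geq \cdots \geq n_{r-1}$. Then $$\mathrm{def}\left(K_{n_{1},n_{2},\ldots,n_{r}}\right)\leq \sum_{i=2}^{r-1}n_{i}^{2}.$$
   Context: All graphs are finite, simple, undirected. $K_{n_1,\ldots,n_r}$ denotes the complete $r$-partite graph whose vertex set is partitioned into independent sets of sizes $n_1,\ldots,n_r$, with every two vertices in different parts adjacent. For a proper edge-coloring $\alpha$ of a graph $G$ (with positive integer colors) and a vertex $v$, let $S(v,\alpha)$ be the set of colors on edges incident to $v$, and $\mathrm{def}(v,\alpha)=\max S(v,\alpha)-\min S(v,\alpha)-|S(v,\alpha)|+1$. The deficiency of $G$ is $\mathrm{def}(G)=\min_\alpha \sum_{v\in V(G)}\mathrm{def}(v,\alpha)$ over all proper edge-colorings $\alpha$ of $G$; equivalently, the minimum number of pendant edges whose attachment to $G$ yields a graph admitting an interval coloring (a proper edge-coloring with colors $1,\ldots,t$, all used, in which every vertex's color set is an integer interval). -}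

module Defs where

open import Data.Nat using (ℕ; zero; suc; _+_; _*_; _∸_; _⊔_; _⊓_; _≤_; _<_; _≟_)
open import Data.Fin using (Fin; toℕ)
import Data.Fin as F
open import Data.List using (List; []; _∷_; map; concatMap; filter; deduplicate; length; foldr; allFin; upTo)
open import Data.Nat.ListAction using (sum)
open import Data.Product using (Σ; _,_; proj₁; proj₂)
open import Relation.Nullary using (¬_; ¬?)
open import Relation.Binary.PropositionalEquality using (_≡_; _≢_)

-- Complete r-partite graph K_{n_1,...,n_r}, with part sizes given by
-- n : ℕ → ℕ using the paper's 1-based indexing: part i (i : Fin r)
-- has size n (1 + toℕ i).
Vertex : (r : ℕ) → (ℕ → ℕ) → Set
Vertex r n = Σ (Fin r) (λ i → Fin (n (suc (toℕ i))))

Adj : (r : ℕ) (n : ℕ → ℕ) → Vertex r n → Vertex r n → Set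
Adj r n u v = proj₁ u ≢ proj₁ v

allVertices : (r : ℕ) (n : ℕ → ℕ) → List (Vertex r n)
allVertices r n = concatMap (λ i → map (i ,_) (allFin (n (suc (toℕ i))))) (allFin r)

neighbours : ∀ {r n} → Vertex r n → List (Vertex r n)
neighbours {r} {n} v = filter (λ w → ¬? (proj₁ v F.≟ proj₁ w)) (allVertices r n)

record ProperEdgeColoring (r : ℕ) (n : ℕ → ℕ) : Set where
  field
    α        : Vertex r n → Vertex r n → ℕ
    symm     : ∀ u v → Adj r n u v → α u v ≡ α v u
    positive : ∀ u v → Adj r n u v → 1 ≤ α u v
    proper   : ∀ u v w → Adj r n u v → Adj r n u w → v ≢ w → α u v ≢ α u w
open ProperEdgeColoring public

maxL : List ℕ → ℕ
maxL = foldr _⊔_ 0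

minL : List ℕ → ℕ
minL []       = 0
minL (x ∷ xs) = foldr _⊓_ x xs

-- S(v, α) as a list of colours (with duplicates removed, so its length is |S|)
S : ∀ {r n} → ProperEdgeColoring r n → Vertex r n → List ℕ
S {r} {n} c v = deduplicate _≟_ (map (α c v) (neighbours {r} {n} v))

-- def(v,α) = max S − min S − |S| + 1   (always ≥ 0)
defV : ∀ {r n} → ProperEdgeColoring r n → Vertex r n → ℕ
defV {r} {n} c v = (maxL (S {r} {n} c v) + 1) ∸ (minL (S {r} {n} c v) + length (S {r} {n} c v))

totalDef : ∀ {r n} → ProperEdgeColoring r n → ℕ
totalDef {r} {n} c = sum (map (defV {r} {n} c) (allVertices r n))

-- def(K_{n_1..n_r}) ≤ k  ⇔  some proper edge-colouring has Σ_v def(v,α) ≤ k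
DefAtMost : (r : ℕ) (n : ℕ → ℕ) (k : ℕ) → Set
DefAtMost r n k = Σ (ProperEdgeColoring r n) (λ c → totalDef {r} {n} c ≤ k)

sqSum : (r : ℕ) (n : ℕ → ℕ) → ℕ
sqSum r n = sum (map (λ i → n (2 + i) * n (2 + i)) (upTo (r ∸ 2)))

module Submission where

-- Number the N vertices 0, …, N − 1 part by part and colour the edge uv with
-- 1 + index u + index v.  This is proper, and a vertex u sees every colour of the
-- window 1 + index u + [0, N) except the block of colours coming from its own part.
-- For the first and the last part that block is at an end of the window, so the
-- colours form an interval; for an interior part i the block has n_i colours, which
-- bounds def(u).  Summing over the n_i vertices of each interior part gives
-- Σ n_i².

open import Defs
open import Data.Nat
open import Data.Nat.Properties
open import Data.Nat.ListAction using (sum)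
open import Data.Nat.ListAction.Properties using (sum-++)
open import Data.Fin using (Fin; toℕ; fromℕ<)
import Data.Fin as Fin
open import Data.Fin.Properties using (toℕ<n; toℕ-injective; toℕ-fromℕ<; injective⇒≤)
open import Data.List using (List; []; _∷_; [_]; _++_; map; length; lookup; concatMap; allFin; tabulate; applyUpTo; upTo)
open import Data.List.Properties using (length-++; length-map; length-upTo; map-++; map-tabulate; length-tabulate; applyUpTo-∷ʳ; map-upTo)
open import Data.List.Membership.Propositional using (_∈_)
open import Data.List.Membership.Propositional.Properties
open import Data.List.Relation.Unary.Any as Any using (here; there)
open import Data.List.Relation.Unary.Any.Properties using (lookup-index)
open import Data.Product using (∃; ∃₂; _×_; _,_; proj₁; proj₂)
open import Data.Sum using (_⊎_; inj₁; inj₂; [_,_]′)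
open import Function.Base using (id; _∘_)
open import Function.Definitions using (Injective)
open import Relation.Nullary using (Dec; ¬?; yes; no; contradiction)
open import Relation.Binary.PropositionalEquality hiding ([_])
open import Relation.Binary.Definitions using (tri<; tri≈; tri>)

intervalDeficiency : List ℕ → ℕ
intervalDeficiency ds = (maxL ds + 1) ∸ (minL ds + length ds)

maxL-∈ : ∀ e es → maxL (e ∷ es) ∈ e ∷ es
maxL-∈ e []       = here (⊔-identityʳ e)
maxL-∈ e (f ∷ es) with ⊔-sel e (maxL (f ∷ es))
... | inj₁ eq = here eq
... | inj₂ eq = there (subst (_∈ f ∷ es) (sym eq) (maxL-∈ f es))

minL-∈ : ∀ e es → minL (e ∷ es) ∈ e ∷ es
minL-∈ e []       = here refl
minL-∈ e (f ∷ es) with ⊓-sel f (minL (e ∷ es)) | minL-∈ e es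
... | inj₁ eq | _       = there (here eq)
... | inj₂ eq | here p  = here (trans eq p)
... | inj₂ eq | there p = there (there (subst (_∈ es) (sym eq) p))

intervalDeficiency-∷-≤ : ∀ {lo k} e es → (∀ {x} → x ∈ e ∷ es → lo ≤ x × x < lo + k) →
  intervalDeficiency (e ∷ es) ≤ k ∸ length (e ∷ es)
intervalDeficiency-∷-≤ {lo} {k} e es window = begin
  (maxL ds + 1) ∸ (minL ds + length ds) ≤⟨ ∸-mono max+1≤ (+-monoˡ-≤ (length ds) lo≤min) ⟩
  (lo + k) ∸ (lo + length ds)           ≡⟨ [m+n]∸[m+o]≡n∸o lo k (length ds) ⟩
  k ∸ length ds                         ∎
  where
  open ≤-Reasoning
  ds : List ℕ
  ds = e ∷ es
  max+1≤ : maxL ds + 1 ≤ lo + k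
  max+1≤ = subst (_≤ lo + k) (+-comm 1 (maxL ds)) (proj₂ (window (maxL-∈ e es)))
  lo≤min : lo ≤ minL ds
  lo≤min = proj₁ (window (minL-∈ e es))

length-≥-covering : ∀ ys lo k → (∀ t → t < k → lo + t ∈ ys) → k ≤ length ys
length-≥-covering ys lo k cover = injective⇒≤ position-injective
  where
  position : Fin k → Fin (length ys)
  position t = Any.index (cover (toℕ t) (toℕ<n t))
  position-injective : Injective _≡_ _≡_ position
  position-injective {s} {t} eq = toℕ-injective (+-cancelˡ-≡ lo (toℕ s) (toℕ t) (begin
    lo + toℕ s              ≡⟨ lookup-index (cover (toℕ s) (toℕ<n s)) ⟩
    lookup ys (position s)  ≡⟨ cong (lookup ys) eq ⟩
    lookup ys (position t)  ≡⟨ lookup-index (cover (toℕ t) (toℕ<n t)) ⟨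
    lo + toℕ t              ∎))
    where open ≡-Reasoning

intervalDeficiency-≤-missing : ∀ ds ms {lo k} → 1 ≤ k →
  (∀ {x} → x ∈ ds → lo ≤ x × x < lo + k) →
  (∀ t → t < k → lo + t ∈ ds ⊎ lo + t ∈ ms) →
  intervalDeficiency ds ≤ length ms
intervalDeficiency-≤-missing [] ms {lo} {k} 1≤k _ cover =
  ≤-trans 1≤k (length-≥-covering ms lo k λ t t<k → [ (λ ()) , id ]′ (cover t t<k))
intervalDeficiency-≤-missing ds@(e ∷ es) ms {lo} {k} 1≤k window cover =
  ≤-trans (intervalDeficiency-∷-≤ e es window) (m≤n+o⇒m∸n≤o k (length ds) counted)
  where
  counted : k ≤ length ds + length ms
  counted = subst (k ≤_) (length-++ ds)
    (length-≥-covering (ds ++ ms) lo k λ t t<k → [ ∈-++⁺ˡ , ∈-++⁺ʳ ds ]′ (cover t t<k))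

offset : (ℕ → ℕ) → ℕ → ℕ
offset n zero    = 0
offset n (suc j) = offset n j + n (suc j)

offset-mono : ∀ n {i j} → i ≤ j → offset n i ≤ offset n j
offset-mono n i≤j = mono′ (≤⇒≤′ i≤j)
  where
  mono′ : ∀ {i j} → i ≤′ j → offset n i ≤ offset n j
  mono′ ≤′-refl     = ≤-refl
  mono′ (≤′-step p) = ≤-trans (mono′ p) (m≤m+n _ _)

offset-decompose : ∀ n r t → t < offset n r →
  ∃₂ λ j a → j < r × a < n (suc j) × offset n j + a ≡ t
offset-decompose n (suc r) t t<offset with t <? offset n r
... | yes t<offset′ =
  let j , a , j<r , a<n , eq = offset-decompose n r t t<offset′
  in j , a , m<n⇒m<1+n j<r , a<n , eq
... | no t≮offset′ =
  r , t ∸ offset n r , n<1+n r ,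
  +-cancelˡ-< (offset n r) _ _ (subst (_< offset n r + n (suc r)) (sym eq) t<offset) , eq
  where
  eq : offset n r + (t ∸ offset n r) ≡ t
  eq = m+[n∸m]≡n (≮⇒≥ t≮offset′)

-- Parts are numbered from 0 here: part j has n (suc j) vertices.
holeSize : ℕ → (ℕ → ℕ) → ℕ → ℕ
holeSize r n zero = 0
holeSize r n (suc j) with suc (suc j) ≟ r
... | yes _ = 0
... | no _  = n (suc (suc j))

holeSize-≤ : ∀ r n j → holeSize r n j ≤ n (suc j)
holeSize-≤ r n zero = z≤n
holeSize-≤ r n (suc j) with suc (suc j) ≟ r
... | yes _ = z≤n
... | no _  = ≤-refl

holeSize-last : ∀ m n → holeSize (suc (suc m)) n (suc m) ≡ 0
holeSize-last m n with suc (suc m) ≟ suc (suc m)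
... | yes _  = refl
... | no ≢m = contradiction refl ≢m

sum-map-mono : ∀ {A : Set} {f g : A → ℕ} → (∀ x → f x ≤ g x) →
  ∀ xs → sum (map f xs) ≤ sum (map g xs)
sum-map-mono f≤g []       = z≤n
sum-map-mono f≤g (x ∷ xs) = +-mono-≤ (f≤g x) (sum-map-mono f≤g xs)

tabulate-toℕ : ∀ {A : Set} (f : ℕ → A) r → tabulate {n = r} (λ i → f (toℕ i)) ≡ applyUpTo f r
tabulate-toℕ f zero    = refl
tabulate-toℕ f (suc r) = cong (f 0 ∷_) (tabulate-toℕ (λ j → f (suc j)) r)

sum-holes-≤-sqSum : ∀ r n → sum (applyUpTo (λ j → n (suc j) * holeSize r n j) r) ≤ sqSum r n
sum-holes-≤-sqSum zero          n = z≤n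
sum-holes-≤-sqSum (suc zero)    n = ≤-reflexive (trans (+-identityʳ (n 1 * 0)) (*-zeroʳ (n 1)))
sum-holes-≤-sqSum (suc (suc m)) n = begin
  n 1 * 0 + sum (applyUpTo hole (suc m))  ≡⟨ cong₂ _+_ (*-zeroʳ (n 1)) (cong sum (sym (applyUpTo-∷ʳ hole m))) ⟩
  sum (applyUpTo hole m ++ [ hole m ])    ≡⟨ sum-++ (applyUpTo hole m) [ hole m ] ⟩
  sum (applyUpTo hole m) + (hole m + 0)   ≡⟨ cong (λ x → sum (applyUpTo hole m) + (x + 0)) last-hole ⟩
  sum (applyUpTo hole m) + 0              ≡⟨ +-identityʳ _ ⟩
  sum (applyUpTo hole m)                  ≡⟨ cong sum (map-upTo hole m) ⟨
  sum (map hole (upTo m))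
    ≤⟨ sum-map-mono (λ i → *-monoʳ-≤ (n (2 + i)) (holeSize-≤ (2 + m) n (suc i))) (upTo m) ⟩
  sqSum (suc (suc m)) n                   ∎
  where
  open ≤-Reasoning
  hole : ℕ → ℕ
  hole i = n (2 + i) * holeSize (2 + m) n (suc i)
  last-hole : hole m ≡ 0
  last-hole = trans (cong (n (2 + m) *_) (holeSize-last m n)) (*-zeroʳ (n (2 + m)))

module KPartite (r : ℕ) (n : ℕ → ℕ) where

  part : Vertex r n → ℕ
  part (i , _) = toℕ i

  index : Vertex r n → ℕ
  index (i , a) = offset n (toℕ i) + toℕ a

  offset-≤-index : ∀ v → offset n (part v) ≤ index v
  offset-≤-index (i , a) = m≤m+n _ _

  index-<-offset : ∀ v → index v < offset n (suc (part v))
  index-<-offset (i , a) = +-monoʳ-< (offset n (toℕ i)) (toℕ<n a)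

  index-<-total : ∀ v → index v < offset n r
  index-<-total v = <-≤-trans (index-<-offset v) (offset-mono n (toℕ<n (proj₁ v)))

  part-<⇒index-< : ∀ v w → part v < part w → index v < index w
  part-<⇒index-< v w p = <-≤-trans (index-<-offset v) (≤-trans (offset-mono n p) (offset-≤-index w))

  index-injective : Injective _≡_ _≡_ index
  index-injective {i , a} {j , b} eq with <-cmp (toℕ i) (toℕ j)
  ... | tri< i<j _ _ = contradiction eq (<⇒≢ (part-<⇒index-< (i , a) (j , b) i<j))
  ... | tri> _ _ j<i = contradiction (sym eq) (<⇒≢ (part-<⇒index-< (j , b) (i , a) j<i))
  ... | tri≈ _ i≡j _ with toℕ-injective i≡j
  ... | refl = cong (i ,_) (toℕ-injective (+-cancelˡ-≡ _ _ _ eq))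

  index-surjective : ∀ t → t < offset n r → ∃ λ v → index v ≡ t
  index-surjective t t<offset with offset-decompose n r t t<offset
  ... | j , a , j<r , a<n , eq =
    (fromℕ< j<r , fromℕ< a<n′) ,
    trans (cong₂ _+_ (cong (offset n) (toℕ-fromℕ< j<r)) (toℕ-fromℕ< a<n′)) eq
    where
    a<n′ : a < n (suc (toℕ (fromℕ< j<r)))
    a<n′ = subst (λ j → a < n (suc j)) (sym (toℕ-fromℕ< j<r)) a<n

  colouring : ProperEdgeColoring r n
  colouring = record
    { α        = λ u v → suc (index u + index v)
    ; symm     = λ u v _ → cong suc (+-comm (index u) (index v))
    ; positive = λ _ _ _ → s≤s z≤n
    ; proper   = λ u v w _ _ v≢w eq →
                   v≢w (index-injective (+-cancelˡ-≡ (index u) _ _ (suc-injective eq)))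
    }

  ∈-allVertices : ∀ v → v ∈ allVertices r n
  ∈-allVertices (i , a) =
    ∈-concatMap⁺ (λ j → map (j ,_) (allFin (n (suc (toℕ j)))))
      (Any.map (λ { refl → ∈-map⁺ (i ,_) (∈-allFin a) }) (∈-allFin i))

  ∈-neighbours⁺ : ∀ u v → proj₁ u ≢ proj₁ v → v ∈ neighbours {r} {n} u
  ∈-neighbours⁺ u v = ∈-filter⁺ (λ w → ¬? (proj₁ u Fin.≟ proj₁ w)) (∈-allVertices v)

  ∈-neighbours⁻ : ∀ u v → v ∈ neighbours {r} {n} u → proj₁ u ≢ proj₁ v
  ∈-neighbours⁻ u v v∈ = proj₂ (∈-filter⁻ (λ w → ¬? (proj₁ u Fin.≟ proj₁ w)) {v} {allVertices r n} v∈)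

  defV-≤-missing : ∀ u s k ms → 1 ≤ k → s + k ≤ offset n r →
    (∀ v → proj₁ u ≢ proj₁ v → s ≤ index v × index v < s + k) →
    (∀ v → proj₁ u ≡ proj₁ v → s ≤ index v → index v < s + k → suc (index u + index v) ∈ ms) →
    defV colouring u ≤ length ms
  defV-≤-missing u s k ms 1≤k s+k≤offset others own =
    intervalDeficiency-≤-missing (S colouring u) ms 1≤k window cover
    where
    colours : List ℕ
    colours = map (α colouring u) (neighbours {r} {n} u)

    window : ∀ {x} → x ∈ S colouring u → suc (index u + s) ≤ x × x < suc (index u + s) + k
    window x∈ with ∈-map⁻ (α colouring u) (∈-deduplicate⁻ _≟_ colours x∈)
    ... | v , v∈ , refl with others v (∈-neighbours⁻ u v v∈)
    ... | s≤ , <s+k =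
      s≤s (+-monoʳ-≤ (index u) s≤) ,
      s≤s (subst (index u + index v <_) (sym (+-assoc (index u) s k)) (+-monoʳ-< (index u) <s+k))

    cover : ∀ t → t < k → suc (index u + s) + t ∈ S colouring u ⊎ suc (index u + s) + t ∈ ms
    cover t t<k with index-surjective (s + t) (<-≤-trans (+-monoʳ-< s t<k) s+k≤offset)
    ... | v , eq = subst (λ c → c ∈ S colouring u ⊎ c ∈ ms) colour≡ (classify (proj₁ u Fin.≟ proj₁ v))
      where
      colour≡ : suc (index u + index v) ≡ suc (index u + s) + t
      colour≡ = cong suc (trans (cong (index u +_) eq) (sym (+-assoc (index u) s t)))

      classify : Dec (proj₁ u ≡ proj₁ v) →
        suc (index u + index v) ∈ S colouring u ⊎ suc (index u + index v) ∈ ms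
      classify (yes same) = inj₂ (own v same (subst (s ≤_) (sym eq) (m≤m+n s t))
                                             (subst (_< s + k) (sym eq) (+-monoʳ-< s t<k)))
      classify (no other) = inj₁ (∈-deduplicate⁺ _≟_ (∈-map⁺ (α colouring u) (∈-neighbours⁺ u v other)))

  defV-≤-partSize : ∀ u → defV colouring u ≤ n (suc (part u))
  defV-≤-partSize u@(i , a) =
    subst (defV colouring u ≤_) (trans (length-map gap (upTo (n (suc (toℕ i))))) (length-upTo _))
      (defV-≤-missing u 0 (offset n r) (map gap (upTo (n (suc (toℕ i)))))
        (≤-trans (s≤s z≤n) (index-<-total u)) ≤-refl
        (λ v _ → z≤n , index-<-total v)
        (λ { (.i , b) refl _ _ → ∈-map⁺ gap (∈-upTo⁺ (toℕ<n b)) }))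
    where
    gap : ℕ → ℕ
    gap b = suc (index u + (offset n (toℕ i) + b))

  defV-first : 2 ≤ r → 1 ≤ n 2 → ∀ u → part u ≡ 0 → defV colouring u ≤ 0
  defV-first 2≤r 1≤n₂ u part≡0 = defV-≤-missing u (n 1) k [] 1≤k (≤-reflexive n₁+k≡) others own
    where
    k : ℕ
    k = offset n r ∸ n 1

    n₁+k≡ : n 1 + k ≡ offset n r
    n₁+k≡ = m+[n∸m]≡n (offset-mono n {1} (≤-trans (s≤s z≤n) 2≤r))

    1≤k : 1 ≤ k
    1≤k = ≤-trans 1≤n₂ (subst (_≤ k) (m+n∸m≡n (n 1) (n 2)) (∸-monoˡ-≤ (n 1) (offset-mono n 2≤r)))

    others : ∀ v → proj₁ u ≢ proj₁ v → n 1 ≤ index v × index v < n 1 + k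
    others v u≢v =
      ≤-trans (offset-mono n (n≢0⇒n>0 part≢0)) (offset-≤-index v) ,
      subst (index v <_) (sym n₁+k≡) (index-<-total v)
      where
      part≢0 : part v ≢ 0
      part≢0 part≡0′ = u≢v (toℕ-injective (trans part≡0 (sym part≡0′)))

    own : ∀ v → proj₁ u ≡ proj₁ v → n 1 ≤ index v → index v < n 1 + k → suc (index u + index v) ∈ []
    own v same n₁≤index _ = contradiction n₁≤index (<⇒≱ index<n₁)
      where
      index<n₁ : index v < n 1
      index<n₁ = subst (λ j → index v < offset n (suc j)) (trans (cong toℕ (sym same)) part≡0) (index-<-offset v)

  defV-last : 1 ≤ n 1 → ∀ u → 1 ≤ part u → suc (part u) ≡ r → defV colouring u ≤ 0
  defV-last 1≤n₁ u 1≤part last =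
    defV-≤-missing u 0 (offset n (part u)) [] (≤-trans 1≤n₁ (offset-mono n 1≤part))
      (offset-mono n (subst (part u ≤_) last (n≤1+n _))) others own
    where
    others : ∀ v → proj₁ u ≢ proj₁ v → 0 ≤ index v × index v < offset n (part u)
    others v u≢v = z≤n , <-≤-trans (index-<-offset v) (offset-mono n part<)
      where
      part< : part v < part u
      part< = ≤∧≢⇒< (s≤s⁻¹ (subst (part v <_) (sym last) (toℕ<n (proj₁ v))))
                     (λ eq → u≢v (toℕ-injective (sym eq)))

    own : ∀ v → proj₁ u ≡ proj₁ v → 0 ≤ index v → index v < offset n (part u) → suc (index u + index v) ∈ []
    own v same _ index< =
      contradiction (subst (λ j → offset n j ≤ index v) (cong toℕ (sym same)) (offset-≤-index v)) (<⇒≱ index<)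

  defV-≤-holeSize : 2 ≤ r → 1 ≤ n 1 → 1 ≤ n 2 → ∀ u → defV colouring u ≤ holeSize r n (part u)
  defV-≤-holeSize 2≤r 1≤n₁ 1≤n₂ u = bound (part u) refl
    where
    bound : ∀ j → part u ≡ j → defV colouring u ≤ holeSize r n j
    bound zero    part≡ = defV-first 2≤r 1≤n₂ u part≡
    bound (suc j) part≡ with suc (suc j) ≟ r
    ... | yes last = defV-last 1≤n₁ u (subst (1 ≤_) (sym part≡) (s≤s z≤n)) (trans (cong suc part≡) last)
    ... | no _     = subst (λ p → defV colouring u ≤ n (suc p)) part≡ (defV-≤-partSize u)

  sum-byPart : (f : ℕ → ℕ) →
    sum (map (λ v → f (part v)) (allVertices r n)) ≡ sum (applyUpTo (λ j → n (suc j) * f j) r)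
  sum-byPart f = begin
    sum (map (f ∘ part) (concatMap block (allFin r)))  ≡⟨ sum-concatMap-block (allFin r) ⟩
    sum (map weight (allFin r))                        ≡⟨ cong sum (map-tabulate {n = r} id weight) ⟩
    sum (tabulate weight)                              ≡⟨ cong sum (tabulate-toℕ (λ j → n (suc j) * f j) r) ⟩
    sum (applyUpTo (λ j → n (suc j) * f j) r)          ∎
    where
    open ≡-Reasoning
    block : (i : Fin r) → List (Vertex r n)
    block i = map (i ,_) (allFin (n (suc (toℕ i))))

    weight : Fin r → ℕ
    weight i = n (suc (toℕ i)) * f (toℕ i)

    sum-map-part : ∀ i (as : List (Fin (n (suc (toℕ i))))) →
      sum (map (f ∘ part) (map (i ,_) as)) ≡ length as * f (toℕ i)
    sum-map-part i []       = refl
    sum-map-part i (a ∷ as) = cong (f (toℕ i) +_) (sum-map-part i as)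

    sum-block : ∀ i → sum (map (f ∘ part) (block i)) ≡ weight i
    sum-block i = trans (sum-map-part i (allFin _))
                        (cong (_* f (toℕ i)) (length-tabulate {n = n (suc (toℕ i))} id))

    sum-concatMap-block : ∀ is → sum (map (f ∘ part) (concatMap block is)) ≡ sum (map weight is)
    sum-concatMap-block []       = refl
    sum-concatMap-block (i ∷ is) = begin
      sum (map (f ∘ part) (block i ++ concatMap block is))
        ≡⟨ cong sum (map-++ (f ∘ part) (block i) (concatMap block is)) ⟩
      sum (map (f ∘ part) (block i) ++ map (f ∘ part) (concatMap block is))
        ≡⟨ sum-++ (map (f ∘ part) (block i)) _ ⟩
      sum (map (f ∘ part) (block i)) + sum (map (f ∘ part) (concatMap block is))
        ≡⟨ cong₂ _+_ (sum-block i) (sum-concatMap-block is) ⟩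
      weight i + sum (map weight is) ∎

theorem6 : (r : ℕ) → 3 ≤ r → (n : ℕ → ℕ) →
    (∀ i → 1 ≤ i → i ≤ r → 1 ≤ n i) →
    n r ≤ n 1 →
    n 2 ≤ n r →
    (∀ i → 2 ≤ i → suc i ≤ r ∸ 1 → n (suc i) ≤ n i) →
    DefAtMost r n (sqSum r n)
theorem6 r 3≤r n positive _ _ _ = colouring , (begin
  totalDef colouring
    ≤⟨ sum-map-mono (defV-≤-holeSize 2≤r 1≤n₁ 1≤n₂) (allVertices r n) ⟩
  sum (map (λ v → holeSize r n (part v)) (allVertices r n))   ≡⟨ sum-byPart (holeSize r n) ⟩
  sum (applyUpTo (λ j → n (suc j) * holeSize r n j) r)        ≤⟨ sum-holes-≤-sqSum r n ⟩
  sqSum r n                                                   ∎)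
  where
  open KPartite r n
  open ≤-Reasoning
  2≤r : 2 ≤ r
  2≤r = ≤-trans (n≤1+n 2) 3≤r
  1≤n₁ : 1 ≤ n 1
  1≤n₁ = positive 1 ≤-refl (≤-trans (s≤s z≤n) 3≤r)
  1≤n₂ : 1 ≤ n 2
  1≤n₂ = positive 2 (s≤s z≤n) 2≤r
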